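{- Let $\mathcal H\subseteq 2^V$ be a unimodular Sperner hypergraph, $V=V_1\dot\cup V_2$ with $V_1,V_2\ne\emptyset$, and $S_1\subseteq V_1$, $S_2\subseteq V_2$ nonempty, such that: every $H\in\mathcal H$ with $H\cap V_1\neq\emptyset\neq H\cap V_2$ satisfies $H\cap V_1=S_1$ or $H\cap V_2=S_2$; $\mathcal H(V_1,S_1)\neq\emptyset$, $\mathcal H(V_1,S_1)^{V_2}\neq\{\emptyset\}$, $\mathcal H(V_2,S_2)\neq\emptyset$, $\mathcal H(V_2,S_2)^{V_1}\neq\{\emptyset\}$; $|V_1|+|\mathcal H_{V_1}\cup\mathcal H(V_2,S_2)|\ge 4$ and $|V_2|+|\mathcal H_{V_2}\cup\mathcal H(V_1,S_1)|\ge4$; and there is $H_0\in\mathcal H$ with $H_0\subseteq S_1\cup S_2$, $H_0\cap V_1=S_1$ and $H_0\cap V_2\subseteq S_2$. Let $v_1,v_2$ be new vertices and define $\bar\mathcal H_1=\mathcal H_{V_1}\cup\{(H\setminus S_2)\cup\{v_2\}\mid H\in\mathcal H(V_2,S_2)\}\cup\{(H_0\setminus S_2)\cup\{v_2\}\}\subseteq 2^{V_1\cup\{v_2\}}$ and $\bar\mathcal H_2=\mathcal H_{V_2}\cup\{(H\setminus S_1)\cup\{v_1\}\mid H\in\mathcal H(V_1,S_1)\}\subseteq 2^{V_2\cup\{v_1\}}$. Then both $\bar\mathcal H_1$ and $\bar\mathcal H_2$ are unimodular.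
   Context: A hypergraph $\mathcal H\subseteq 2^V$ is Sperner if no hyperedge contains another; it is unimodular if its hyperedge–vertex incidence $0/1$ matrix is totally unimodular (every square subdeterminant in $\{ -1,0,1\}$). Notation: $\mathcal H_S=\{H\in\mathcal H\mid H\subseteq S\}$; $\mathcal H^S=\operatorname{Min}\{H\cap S\mid H\in\mathcal H\}$ ($\operatorname{Min}$ = inclusion-minimal members); $\mathcal H(W,S)=\{H\in\mathcal H\mid H\cap W=S\}$. -}

module Defs where

open import Data.Nat using (ℕ; zero; suc)
open import Data.Bool using (Bool; true; false; if_then_else_)
import Data.Bool.Properties as BoolP
open import Data.Fin using (Fin; zero; suc; punchIn; toℕ)
open import Data.Fin.Subset using (Subset; _∩_; _∪_; _─_; _⊆_; ⊥; inside; outside)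
open import Data.Fin.Subset.Properties using (_⊆?_)
open import Data.Vec using (_∷_; lookup)
open import Data.Vec.Properties using (≡-dec)
open import Data.Integer using (ℤ; _+_; _*_; _^_; -1ℤ; 0ℤ; 1ℤ)
open import Data.List using (List; []; _∷_; _++_; map; filter; length; deduplicate)
import Data.List as L
open import Data.List.Membership.Propositional using (_∈_)
open import Data.Product using (_×_)
open import Data.Sum using (_⊎_)
open import Function.Definitions using (Injective)
open import Relation.Binary.PropositionalEquality using (_≡_)
open import Relation.Binary.Definitions using (DecidableEquality)

-- A hypergraph on vertex set Fin n: a (finite) list of hyperedges, read as a set.
Hypergraph : ℕ → Set
Hypergraph n = List (Subset n)

_≟ₛ_ : ∀ {n} → DecidableEquality (Subset n)
_≟ₛ_ = ≡-dec BoolP._≟_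

card : ∀ {n} → Hypergraph n → ℕ
card ℋ = length (deduplicate _≟ₛ_ ℋ)

Sperner : ∀ {n} → Hypergraph n → Set
Sperner ℋ = ∀ {H H′} → H ∈ ℋ → H′ ∈ ℋ → H ⊆ H′ → H ≡ H′

restrict : ∀ {n} → Hypergraph n → Subset n → Hypergraph n
restrict ℋ S = filter (_⊆? S) ℋ

-- ℋ(W,S) = {H ∈ ℋ | H ∩ W = S}
traceEq : ∀ {n} → Hypergraph n → Subset n → Subset n → Hypergraph n
traceEq ℋ W S = filter (λ H → (H ∩ W) ≟ₛ S) ℋ

InMin : ∀ {n} → List (Subset n) → Subset n → Set
InMin 𝒜 X = X ∈ 𝒜 × (∀ {Y} → Y ∈ 𝒜 → Y ⊆ X → Y ≡ X)

-- X ∈ ℋ^S = Min {H ∩ S | H ∈ ℋ}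
InProj : ∀ {n} → Hypergraph n → Subset n → Subset n → Set
InProj ℋ S X = InMin (map (_∩ S) ℋ) X

ProjIsEmptySet : ∀ {n} → Hypergraph n → Subset n → Set
ProjIsEmptySet ℋ S = ∀ X → (InProj ℋ S X → X ≡ ⊥) × (X ≡ ⊥ → InProj ℋ S X)

sumFin : ∀ k → (Fin k → ℤ) → ℤ
sumFin zero f = 0ℤ
sumFin (suc k) f = f zero + sumFin k (λ i → f (suc i))

det : ∀ k → (Fin k → Fin k → ℤ) → ℤ
det zero M = 1ℤ
det (suc k) M =
  sumFin (suc k) (λ j → (-1ℤ ^ toℕ j) * (M zero j * det k (λ r c → M (suc r) (punchIn j c))))

incidence : ∀ {n} → Subset n → Fin n → ℤ
incidence H v = if lookup H v then 1ℤ else 0ℤ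

Unimodular : ∀ {n} → Hypergraph n → Set
Unimodular {n} ℋ =
  ∀ k (r : Fin k → Fin (length ℋ)) (c : Fin k → Fin n) →
  Injective _≡_ _≡_ r → Injective _≡_ _≡_ c →
  let d = det k (λ i j → incidence (L.lookup ℋ (r i)) (c j)) in
  d ≡ -1ℤ ⊎ d ≡ 0ℤ ⊎ d ≡ 1ℤ

-- embedding 2^V → 2^(V ∪ {v}) where the new vertex v is index zero of Fin (suc n)
old : ∀ {n} → Subset n → Subset (suc n)
old H = outside ∷ H

withNew : ∀ {n} → Subset n → Subset (suc n)
withNew X = inside ∷ X

barH₁ : ∀ {n} → Hypergraph n → Subset n → Subset n → Subset n → Subset n → Hypergraph (suc n)
barH₁ ℋ V₁ V₂ S₂ H₀ =
  map old (restrict ℋ V₁) ++ map (λ H → withNew (H ─ S₂)) (traceEq ℋ V₂ S₂) ++ (withNew (H₀ ─ S₂) ∷ [])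

barH₂ : ∀ {n} → Hypergraph n → Subset n → Subset n → Subset n → Hypergraph (suc n)
barH₂ ℋ V₁ V₂ S₁ =
  map old (restrict ℋ V₂) ++ map (λ H → withNew (H ─ S₁)) (traceEq ℋ V₁ S₁)

module Submission where

-- Choose s₂ ∈ H₀ ∩ V₂: it exists, for otherwise H₀ = S₁ would lie in every member of ℋ(V₁,S₁),
-- which by the Sperner property is then {H₀}, with projection {∅} to V₂. Read the new vertex v₂
-- as s₂. Then every hyperedge of H̄₁ is empty on V₂ and agrees with a hyperedge H of ℋ on
-- V₁ ∪ {s₂}: for (H ∖ S₂) ∪ {v₂} this uses H ∩ V₂ ⊆ S₂ and s₂ ∈ H. So a square submatrix of the
-- incidence matrix of H̄₁ has a zero column (a vertex of V₂), or two equal rows (read off the same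
-- hyperedge of ℋ), or is a square submatrix of the incidence matrix of ℋ. The same argument, with
-- v₁ read as any s₁ ∈ S₁, applies to H̄₂.

module Determinant where

  open import Defs
  open import Data.Nat using (ℕ; zero; suc)
  open import Data.Fin as F using (Fin; zero; suc; punchIn; punchOut)
  open import Data.Fin.Properties using (_≟_; punchIn-punchOut)
  open import Data.Integer using (ℤ; +0; +[1+_]; -[1+_]; _+_; _*_; _^_; -_; -1ℤ; 0ℤ; 1ℤ)
  open import Data.Integer.Properties using (*-identityˡ; *-zeroʳ; *-distribˡ-+; +-identityˡ; +-assoc; neg-distrib-+)
  open import Data.Integer.Tactic.RingSolver using (solve-∀)
  open import Data.Empty using (⊥-elim)
  open import Function using (_∘_)
  open import Relation.Nullary using (yes; no)
  open import Relation.Binary.PropositionalEquality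

  sign : ∀ {k} → Fin k → ℤ
  sign j = -1ℤ ^ F.toℕ j

  sumFin-cong : ∀ k {f g : Fin k → ℤ} → f ≗ g → sumFin k f ≡ sumFin k g
  sumFin-cong zero     f≗g = refl
  sumFin-cong (suc k) f≗g = cong₂ _+_ (f≗g zero) (sumFin-cong k (f≗g ∘ suc))

  sumFin-zero : ∀ k {f : Fin k → ℤ} → (∀ i → f i ≡ 0ℤ) → sumFin k f ≡ 0ℤ
  sumFin-zero zero     f≡0 = refl
  sumFin-zero (suc k) f≡0 = cong₂ _+_ (f≡0 zero) (sumFin-zero k (f≡0 ∘ suc))

  sumFin-+ : ∀ k (f g : Fin k → ℤ) → sumFin k (λ i → f i + g i) ≡ sumFin k f + sumFin k g
  sumFin-+ zero     f g = refl
  sumFin-+ (suc k) f g =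
    trans (cong ((f zero + g zero) +_) (sumFin-+ k (f ∘ suc) (g ∘ suc)))
          (interchange (f zero) (g zero) (sumFin k (f ∘ suc)) (sumFin k (g ∘ suc)))
    where
    interchange : ∀ a b c d → a + b + (c + d) ≡ a + c + (b + d)
    interchange = solve-∀

  sumFin-*ˡ : ∀ k c (f : Fin k → ℤ) → sumFin k (λ i → c * f i) ≡ c * sumFin k f
  sumFin-*ˡ zero     c f = sym (*-zeroʳ c)
  sumFin-*ˡ (suc k) c f =
    trans (cong ((c * f zero) +_) (sumFin-*ˡ k c (f ∘ suc))) (sym (*-distribˡ-+ c (f zero) _))

  sumFin-neg : ∀ k (f : Fin k → ℤ) → sumFin k (λ i → - f i) ≡ - sumFin k f
  sumFin-neg zero     f = refl
  sumFin-neg (suc k) f =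
    trans (cong ((- f zero) +_) (sumFin-neg k (f ∘ suc))) (sym (neg-distrib-+ (f zero) _))

  i+i≡0⇒i≡0 : ∀ i → i + i ≡ 0ℤ → i ≡ 0ℤ
  i+i≡0⇒i≡0 +0        _ = refl
  i+i≡0⇒i≡0 +[1+ n ] ()
  i+i≡0⇒i≡0 -[1+ n ]  ()

  Matrix : ℕ → Set
  Matrix k = Fin k → Fin k → ℤ

  minor : ∀ {k} → Matrix (suc k) → Fin (suc k) → Matrix k
  minor M j r c = M (suc r) (punchIn j c)

  det-cong : ∀ k {M N : Matrix k} → (∀ i j → M i j ≡ N i j) → det k M ≡ det k N
  det-cong zero     M≡N = refl
  det-cong (suc k) M≡N = sumFin-cong (suc k) λ j →
    cong₂ (λ x y → sign j * (x * y)) (M≡N zero j) (det-cong k (λ r c → M≡N (suc r) (punchIn j c)))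

  det-minors≡0 : ∀ k (M : Matrix (suc k)) → (∀ j → det k (minor M j) ≡ 0ℤ) → det (suc k) M ≡ 0ℤ
  det-minors≡0 k M minors≡0 = sumFin-zero (suc k) λ j →
    trans (cong (λ d → sign j * (M zero j * d)) (minors≡0 j))
          (trans (cong (sign j *_) (*-zeroʳ (M zero j))) (*-zeroʳ (sign j)))

  Congruent : ∀ {w m} → ((Fin w → Fin m) → ℤ) → Set
  Congruent X = ∀ {f g} → f ≗ g → X f ≡ X g

  -- Laplace expansion along two rows a, b; X f stands for the determinant of the
  -- remaining rows restricted to the columns f, so that det (2 + w) M is definitionally
  -- expand₂ w (M zero) (M (suc zero)) (λ f → det w (λ r c → M (suc (suc r)) (f c))).
  expand₂ : ∀ w (a b : Fin (suc (suc w)) → ℤ) → ((Fin w → Fin (suc (suc w))) → ℤ) → ℤ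
  expand₂ w a b X = sumFin (suc (suc w)) λ j → sign j * (a j * sumFin (suc w) λ l →
    sign l * (b (punchIn j l) * X (punchIn j ∘ punchIn l)))

  expandTail : ∀ w (b : Fin (suc (suc w)) → ℤ) → ((Fin w → Fin (suc (suc w))) → ℤ) → ℤ
  expandTail w b X = sumFin (suc w) λ l → sign l * (b (suc l) * X (suc ∘ punchIn l))

  expand₂Tail : ∀ w (a b : Fin (suc (suc w)) → ℤ) → ((Fin w → Fin (suc (suc w))) → ℤ) → ℤ
  expand₂Tail w a b X = sumFin (suc w) λ j → sign j * (a (suc j) * sumFin w λ l →
    sign l * (b (suc (punchIn j l)) * X (punchIn (suc j) ∘ punchIn (suc l))))

  expand₂-split : ∀ w a b X →
    expand₂ w a b X ≡ a zero * expandTail w b X + - (b zero * expandTail w a X) + expand₂Tail w a b X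
  expand₂-split w a b X =
    begin
      expand₂ w a b X
    ≡⟨ cong₂ _+_ (*-identityˡ (a zero * expandTail w b X)) (sumFin-cong (suc w) term) ⟩
      a zero * expandTail w b X + sumFin (suc w) (λ j → - (b zero * A j) + sign j * (a (suc j) * B j))
    ≡⟨ cong (a zero * expandTail w b X +_)
            (sumFin-+ (suc w) (λ j → - (b zero * A j)) (λ j → sign j * (a (suc j) * B j))) ⟩
      a zero * expandTail w b X + (sumFin (suc w) (λ j → - (b zero * A j)) + expand₂Tail w a b X)
    ≡⟨ cong (λ z → a zero * expandTail w b X + (z + expand₂Tail w a b X)) pull-b₀ ⟩
      a zero * expandTail w b X + (- (b zero * expandTail w a X) + expand₂Tail w a b X)
    ≡⟨ sym (+-assoc (a zero * expandTail w b X) (- (b zero * expandTail w a X)) (expand₂Tail w a b X)) ⟩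
      a zero * expandTail w b X + - (b zero * expandTail w a X) + expand₂Tail w a b X
    ∎
    where
    open ≡-Reasoning
    X₀ : Fin (suc w) → ℤ
    X₀ j = X (suc ∘ punchIn j)
    A : Fin (suc w) → ℤ
    A j = sign j * (a (suc j) * X₀ j)
    Y : Fin (suc w) → Fin w → ℤ
    Y j l = b (suc (punchIn j l)) * X (punchIn (suc j) ∘ punchIn (suc l))
    B : Fin (suc w) → ℤ
    B j = sumFin w (λ l → sign l * Y j l)
    flip-inner : ∀ j → sumFin w (λ l → (-1ℤ * sign l) * Y j l) ≡ - B j
    flip-inner j = trans (sumFin-cong w (λ l → negate (sign l) (Y j l))) (sumFin-neg w (λ l → sign l * Y j l))
      where
      negate : ∀ s y → (-1ℤ * s) * y ≡ - (s * y)
      negate = solve-∀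
    term : ∀ j → (-1ℤ * sign j) * (a (suc j) * (1ℤ * (b zero * X₀ j) + sumFin w (λ l → (-1ℤ * sign l) * Y j l)))
               ≡ - (b zero * A j) + sign j * (a (suc j) * B j)
    term j = trans (cong (λ z → (-1ℤ * sign j) * (a (suc j) * (1ℤ * (b zero * X₀ j) + z))) (flip-inner j))
                   (rearrange (sign j) (a (suc j)) (b zero) (X₀ j) (B j))
      where
      rearrange : ∀ s a b x z → (-1ℤ * s) * (a * (1ℤ * (b * x) + - z)) ≡ - (b * (s * (a * x))) + s * (a * z)
      rearrange = solve-∀
    pull-b₀ : sumFin (suc w) (λ j → - (b zero * A j)) ≡ - (b zero * expandTail w a X)
    pull-b₀ = trans (sumFin-neg (suc w) (λ j → b zero * A j)) (cong -_ (sumFin-*ˡ (suc w) (b zero) A))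

  expand₂Tail-zero : ∀ a b X → expand₂Tail 0 a b X ≡ 0ℤ
  expand₂Tail-zero a b X = cong (λ z → 1ℤ * z + 0ℤ) (*-zeroʳ (a (suc zero)))

  expand₂Tail-suc : ∀ w a b X → Congruent X →
    expand₂Tail (suc w) a b X ≡ expand₂ w (a ∘ suc) (b ∘ suc) (X ∘ F.lift 1)
  expand₂Tail-suc w a b X X-cong = sumFin-cong (suc (suc w)) λ j → cong (λ z → sign j * (a (suc j) * z))
    (sumFin-cong (suc w) λ l → cong (λ z → sign l * (b (suc (punchIn j l)) * z))
      (X-cong {f = punchIn (suc j) ∘ punchIn (suc l)} {g = F.lift 1 (punchIn j ∘ punchIn l)}
              λ { zero → refl ; (suc c) → refl }))

  expand₂-antisym : ∀ w a b X → Congruent X → expand₂ w a b X + expand₂ w b a X ≡ 0ℤ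

  expand₂Tail-antisym : ∀ w a b X → Congruent X → expand₂Tail w a b X + expand₂Tail w b a X ≡ 0ℤ
  expand₂Tail-antisym zero    a b X X-cong = cong₂ _+_ (expand₂Tail-zero a b X) (expand₂Tail-zero b a X)
  expand₂Tail-antisym (suc w) a b X X-cong =
    trans (cong₂ _+_ (expand₂Tail-suc w a b X X-cong) (expand₂Tail-suc w b a X X-cong))
          (expand₂-antisym w (a ∘ suc) (b ∘ suc) (X ∘ F.lift 1)
             λ f≗g → X-cong λ { zero → refl ; (suc c) → cong suc (f≗g c) })

  expand₂-antisym w a b X X-cong =
    trans (cong₂ _+_ (expand₂-split w a b X) (expand₂-split w b a X))
          (trans (cancel (a zero * expandTail w b X) (b zero * expandTail w a X) _ _)
                 (expand₂Tail-antisym w a b X X-cong))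
    where
    cancel : ∀ x y r s → x + - y + r + (y + - x + s) ≡ r + s
    cancel = solve-∀

  swap₀₁ : ∀ {w} → Fin (suc (suc w)) → Fin (suc (suc w))
  swap₀₁ zero          = suc zero
  swap₀₁ (suc zero)    = zero
  swap₀₁ (suc (suc i)) = suc (suc i)

  det-swap₀₁ : ∀ w (M : Matrix (suc (suc w))) → det (suc (suc w)) (M ∘ swap₀₁) + det (suc (suc w)) M ≡ 0ℤ
  det-swap₀₁ w M = expand₂-antisym w (M (suc zero)) (M zero) (λ f → det w (λ r c → M (suc (suc r)) (f c)))
    λ f≗g → det-cong w (λ r c → cong (M (suc (suc r))) (f≗g c))

  det-equalRows₀ : ∀ {k} (M : Matrix (suc k)) (q : Fin k) → (∀ c → M zero c ≡ M (suc q) c) → det (suc k) M ≡ 0ℤ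
  det-equalRows₀ {suc w} M zero row₀≡row₁ =
    i+i≡0⇒i≡0 (det (suc (suc w)) M)
      (trans (cong (_+ det (suc (suc w)) M) (det-cong (suc (suc w)) swap-fixes)) (det-swap₀₁ w M))
    where
    swap-fixes : ∀ i c → M i c ≡ M (swap₀₁ i) c
    swap-fixes zero          c = row₀≡row₁ c
    swap-fixes (suc zero)    c = sym (row₀≡row₁ c)
    swap-fixes (suc (suc i)) c = refl
  -- After swapping rows 0 and 1 the two equal rows are both non-zero, so every minor
  -- along row 0 again has its row 0 repeated further down.
  det-equalRows₀ {suc w} M (suc q) row₀≡row =
    trans (sym (+-identityˡ (det (suc (suc w)) M)))
          (trans (cong (_+ det (suc (suc w)) M) (sym swapped≡0)) (det-swap₀₁ w M))
    where
    swapped≡0 : det (suc (suc w)) (M ∘ swap₀₁) ≡ 0ℤ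
    swapped≡0 = det-minors≡0 (suc w) (M ∘ swap₀₁) λ j →
      det-equalRows₀ (minor (M ∘ swap₀₁) j) q (λ c → row₀≡row (punchIn j c))

  det-equalRows : ∀ k (M : Matrix k) {p q} → p ≢ q → (∀ c → M p c ≡ M q c) → det k M ≡ 0ℤ
  det-equalRows (suc k) M {zero}  {zero}  p≢q _        = ⊥-elim (p≢q refl)
  det-equalRows (suc k) M {zero}  {suc q} _   rows≡    = det-equalRows₀ M q rows≡
  det-equalRows (suc k) M {suc p} {zero}  _   rows≡    = det-equalRows₀ M p (sym ∘ rows≡)
  det-equalRows (suc k) M {suc p} {suc q} p≢q rows≡    = det-minors≡0 k M λ j →
    det-equalRows k (minor M j) (p≢q ∘ cong suc) (rows≡ ∘ punchIn j)

  det-zeroColumn : ∀ k (M : Matrix k) c → (∀ i → M i c ≡ 0ℤ) → det k M ≡ 0ℤ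
  det-zeroColumn (suc k) M c column≡0 = sumFin-zero (suc k) term
    where
    term : ∀ j → sign j * (M zero j * det k (minor M j)) ≡ 0ℤ
    term j with j ≟ c
    ... | yes refl = trans (cong (λ x → sign j * (x * det k (minor M j))) (column≡0 zero))
                           (*-zeroʳ (sign j))
    ... | no j≢c  = trans (cong (λ d → sign j * (M zero j * d))
                            (det-zeroColumn k (minor M j) (punchOut j≢c)
                              λ i → trans (cong (M (suc i)) (punchIn-punchOut j≢c)) (column≡0 (suc i))))
                          (trans (cong (sign j *_) (*-zeroʳ (M zero j))) (*-zeroʳ (sign j)))

open import Defs
open import Data.Nat using (suc; _+_; _≥_)
open import Data.Bool using (if_then_else_)
open import Data.Bool.Properties using (¬-not)
open import Data.Fin using (Fin; zero; suc)
open import Data.Fin.Properties using (_≟_; any?)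
open import Data.Fin.Subset using (Subset; _∩_; _∪_; _─_; _⊆_; ⊥; ⊤; Nonempty; ∣_∣; inside; outside)
  renaming (_∈_ to _∈ₛ_; _∉_ to _∉ₛ_)
open import Data.Fin.Subset.Properties
  using (_∈?_; _⊆?_; nonempty?; Empty-unique; ∉⊥; ∈⊤; ⊆-reflexive; x∈p∩q⁺; x∈p∩q⁻; x∈p∪q⁻; drop-there; drop-not-there)
open import Data.Integer using (-1ℤ; 0ℤ; 1ℤ)
open import Data.List as List using (_++_; map; length)
open import Data.List.Membership.Propositional using (_∈_)
open import Data.List.Membership.Propositional.Properties using (∈-lookup; ∈-filter⁻; ∈-filter⁺; ∈-map⁺; ∈-map⁻)
open import Data.List.Relation.Unary.All as All using (All; []; _∷_)
import Data.List.Relation.Unary.All.Properties as All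
open import Data.List.Relation.Unary.Any using (index)
open import Data.List.Relation.Unary.Any.Properties using (lookup-index)
open import Data.Product using (_×_; _,_; proj₁; proj₂; ∃-syntax)
open import Data.Sum using (_⊎_; inj₁; inj₂)
open import Data.Empty using (⊥-elim)
open import Data.Vec using (_∷_; lookup; here; there)
open import Data.Vec.Properties using ([]=⇒lookup; lookup⇒[]=)
open import Function using (_∘_)
open import Relation.Nullary using (¬_; yes; no; ¬?)
open import Relation.Nullary.Decidable using (_×-dec_)
open import Relation.Binary.PropositionalEquality
open Determinant using (det-cong; det-equalRows; det-zeroColumn)

x∉p⇒lookup≡outside : ∀ {n} {x} {p : Subset n} → x ∉ₛ p → lookup p x ≡ outside
x∉p⇒lookup≡outside {x = x} {p} x∉p = ¬-not (x∉p ∘ lookup⇒[]= x p)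

x∈p─q⁻ : ∀ {n} {x} (p q : Subset n) → x ∈ₛ p ─ q → x ∈ₛ p × x ∉ₛ q
x∈p─q⁻ (_ ∷ p)      (_ ∷ q)       (there x∈) = let x∈p , x∉q = x∈p─q⁻ p q x∈ in there x∈p , x∉q ∘ drop-there
x∈p─q⁻ (inside ∷ p) (outside ∷ q) here       = here , λ ()

lookup-─-∉ : ∀ {n} {x} (p q : Subset n) → x ∉ₛ q → lookup (p ─ q) x ≡ lookup p x
lookup-─-∉ {x = zero}  (_ ∷ p) (outside ∷ q) _   = refl
lookup-─-∉ {x = zero}  (_ ∷ p) (inside ∷ q)  x∉q = ⊥-elim (x∉q here)
lookup-─-∉ {x = suc x} (_ ∷ p) (_ ∷ q)       x∉q = lookup-─-∉ p q (x∉q ∘ there)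

incidence-∉ : ∀ {n} {X : Subset n} {v} → v ∉ₛ X → incidence X v ≡ 0ℤ
incidence-∉ v∉X = cong (if_then 1ℤ else 0ℤ) (x∉p⇒lookup≡outside v∉X)

record Reindexes {m n} (Z : Subset m) (σ : Fin m → Fin n) (X : Subset m) (H : Subset n) : Set where
  field
    zeroed : ∀ {v} → v ∈ₛ Z → v ∉ₛ X
    agrees : ∀ {v} → v ∉ₛ Z → lookup X v ≡ lookup H (σ v)

ReindexedRow : ∀ {m n} → Hypergraph n → Subset m → (Fin m → Fin n) → Subset m → Set
ReindexedRow ℋ Z σ X = ∃[ H ] H ∈ ℋ × Reindexes Z σ X H

Unimodular-reindex : ∀ {m n} {𝒢 : Hypergraph m} {ℋ : Hypergraph n} (Z : Subset m) (σ : Fin m → Fin n) →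
  (∀ {v w} → v ∉ₛ Z → w ∉ₛ Z → σ v ≡ σ w → v ≡ w) →
  All (ReindexedRow ℋ Z σ) 𝒢 → Unimodular ℋ → Unimodular 𝒢
Unimodular-reindex {𝒢 = 𝒢} {ℋ} Z σ σ-injective rows U k r c r-injective c-injective = minor-unimodular
  where
  row : ∀ i → ReindexedRow ℋ Z σ (List.lookup 𝒢 i)
  row i = All.lookup rows (∈-lookup i)
  ρ : Fin (length 𝒢) → Fin (length ℋ)
  ρ i = index (proj₁ (proj₂ (row i)))
  entry : ∀ i {v} → v ∉ₛ Z → incidence (List.lookup 𝒢 i) v ≡ incidence (List.lookup ℋ (ρ i)) (σ v)
  entry i {v} v∉Z = cong (if_then 1ℤ else 0ℤ) (trans (Reindexes.agrees (proj₂ (proj₂ (row i))) v∉Z)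
                                                    (cong (λ H → lookup H (σ v)) (lookup-index (proj₁ (proj₂ (row i))))))
  minor-unimodular : let d = det k (λ i j → incidence (List.lookup 𝒢 (r i)) (c j)) in d ≡ -1ℤ ⊎ d ≡ 0ℤ ⊎ d ≡ 1ℤ
  minor-unimodular with any? (λ j → c j ∈? Z)
  ... | yes (j , cⱼ∈Z) = inj₂ (inj₁ (det-zeroColumn k _ j λ i →
          incidence-∉ (Reindexes.zeroed (proj₂ (proj₂ (row (r i)))) cⱼ∈Z)))
  ... | no c∉Z with any? (λ i → any? λ i′ → ¬? (i ≟ i′) ×-dec (ρ (r i) ≟ ρ (r i′)))
  ...   | yes (i , i′ , i≢i′ , same) = inj₂ (inj₁ (det-equalRows k _ i≢i′ λ j →
            trans (entry (r i) (c∉Z ∘ (j ,_))) (trans (cong (λ t → incidence (List.lookup ℋ t) (σ (c j))) same)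
                  (sym (entry (r i′) (c∉Z ∘ (j ,_)))))))
  ...   | no distinct = subst (λ d → d ≡ -1ℤ ⊎ d ≡ 0ℤ ⊎ d ≡ 1ℤ)
            (sym (det-cong k λ i j → entry (r i) (c∉Z ∘ (j ,_))))
            (U k (ρ ∘ r) (σ ∘ c) ρr-injective (c-injective ∘ σ-injective (c∉Z ∘ (_ ,_)) (c∉Z ∘ (_ ,_))))
    where
    ρr-injective : ∀ {i i′} → ρ (r i) ≡ ρ (r i′) → i ≡ i′
    ρr-injective {i} {i′} same with i ≟ i′
    ... | yes i≡i′ = i≡i′
    ... | no i≢i′  = ⊥-elim (distinct (i , i′ , i≢i′ , same))

mergeInto : ∀ {n} → Fin n → Fin (suc n) → Fin n
mergeInto s zero    = s
mergeInto s (suc u) = u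

mergeInto-injective : ∀ {n} {B : Subset n} {s} → s ∈ₛ B →
  ∀ {v w} → v ∉ₛ old B → w ∉ₛ old B → mergeInto s v ≡ mergeInto s w → v ≡ w
mergeInto-injective s∈B {zero}  {zero}  _   _   _    = refl
mergeInto-injective s∈B {zero}  {suc w} _   w∉B refl = ⊥-elim (w∉B (there s∈B))
mergeInto-injective s∈B {suc v} {zero}  v∉B _   refl = ⊥-elim (v∉B (there s∈B))
mergeInto-injective s∈B {suc v} {suc w} _   _   v≡w  = cong suc v≡w

old-reindexes : ∀ {n} {B H : Subset n} {s} → s ∈ₛ B → (∀ {u} → u ∈ₛ H → u ∉ₛ B) →
  Reindexes (old B) (mergeInto s) (old H) H
old-reindexes {B = B} {H} {s} s∈B H-disjoint-B = record { zeroed = zeroed ; agrees = agrees }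
  where
  zeroed : ∀ {v} → v ∈ₛ old B → v ∉ₛ old H
  zeroed (there u∈B) (there u∈H) = H-disjoint-B u∈H u∈B
  agrees : ∀ {v} → v ∉ₛ old B → lookup (old H) v ≡ lookup H (mergeInto s v)
  agrees {zero}  _ = sym (x∉p⇒lookup≡outside λ s∈H → H-disjoint-B s∈H s∈B)
  agrees {suc u} _ = refl

withNew-reindexes : ∀ {n} {B S H : Subset n} {s} → S ⊆ B → H ∩ B ⊆ S → s ∈ₛ H →
  Reindexes (old B) (mergeInto s) (withNew (H ─ S)) H
withNew-reindexes {B = B} {S} {H} {s} S⊆B H∩B⊆S s∈H = record { zeroed = zeroed ; agrees = agrees }
  where
  zeroed : ∀ {v} → v ∈ₛ old B → v ∉ₛ withNew (H ─ S)
  zeroed (there u∈B) (there u∈H─S) = let u∈H , u∉S = x∈p─q⁻ H S u∈H─S in u∉S (H∩B⊆S (x∈p∩q⁺ (u∈H , u∈B)))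
  agrees : ∀ {v} → v ∉ₛ old B → lookup (withNew (H ─ S)) v ≡ lookup H (mergeInto s v)
  agrees {zero}  _   = sym ([]=⇒lookup s∈H)
  agrees {suc u} u∉B = lookup-─-∉ H S (drop-not-there u∉B ∘ S⊆B)

restrict-reindexes : ∀ {n} (ℋ : Hypergraph n) {A B : Subset n} {s} → (∀ {u} → u ∈ₛ A → u ∉ₛ B) → s ∈ₛ B →
  All (ReindexedRow ℋ (old B) (mergeInto s)) (map old (restrict ℋ A))
restrict-reindexes ℋ {A} A-disjoint-B s∈B = All.map⁺ (All.tabulate λ {H} H∈ →
  let H∈ℋ , H⊆A = ∈-filter⁻ (_⊆? A) H∈ in H , H∈ℋ , old-reindexes s∈B (A-disjoint-B ∘ H⊆A))

traceEq-reindexes : ∀ {n} (ℋ : Hypergraph n) {B S : Subset n} {s} → S ⊆ B → s ∈ₛ S →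
  All (ReindexedRow ℋ (old B) (mergeInto s)) (map (λ H → withNew (H ─ S)) (traceEq ℋ B S))
traceEq-reindexes ℋ {B} {S} S⊆B s∈S = All.map⁺ (All.tabulate λ {H} H∈ →
  let H∈ℋ , H∩B≡S = ∈-filter⁻ (λ H → (H ∩ B) ≟ₛ S) H∈ in
  H , H∈ℋ , withNew-reindexes S⊆B (⊆-reflexive H∩B≡S) (proj₁ (x∈p∩q⁻ H B (subst (_ ∈ₛ_) (sym H∩B≡S) s∈S))))

∩≡⊥⇒disjoint : ∀ {n} {p q : Subset n} → p ∩ q ≡ ⊥ → ∀ {x} → x ∈ₛ p → x ∉ₛ q
∩≡⊥⇒disjoint p∩q≡⊥ x∈p x∈q = ∉⊥ (subst (_ ∈ₛ_) p∩q≡⊥ (x∈p∩q⁺ (x∈p , x∈q)))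

∪≡⊤⇒∩≡⊥⇒⊆ : ∀ {n} {p q H : Subset n} → p ∪ q ≡ ⊤ → H ∩ q ≡ ⊥ → H ⊆ p
∪≡⊤⇒∩≡⊥⇒⊆ {p = p} {q} {H} p∪q≡⊤ H∩q≡⊥ {x} x∈H with x∈p∪q⁻ p q (subst (x ∈ₛ_) (sym p∪q≡⊤) ∈⊤)
... | inj₁ x∈p = x∈p
... | inj₂ x∈q = ⊥-elim (∩≡⊥⇒disjoint H∩q≡⊥ x∈H x∈q)

traceEq-unique : ∀ {n} {ℋ : Hypergraph n} {W S H₀ Y} → Sperner ℋ → H₀ ∈ ℋ → H₀ ⊆ W → H₀ ∩ W ≡ S →
  Y ∈ traceEq ℋ W S → Y ≡ H₀
traceEq-unique {ℋ = ℋ} {W} {S} {H₀} {Y} sperner H₀∈ℋ H₀⊆W H₀∩W≡S Y∈ =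
  sym (sperner H₀∈ℋ Y∈ℋ λ {x} x∈H₀ →
    proj₁ (x∈p∩q⁻ Y W (subst (x ∈ₛ_) (trans H₀∩W≡S (sym Y∩W≡S)) (x∈p∩q⁺ (x∈H₀ , H₀⊆W x∈H₀)))))
  where
  Y∈ℋ : Y ∈ ℋ
  Y∈ℋ = proj₁ (∈-filter⁻ (λ H → (H ∩ W) ≟ₛ S) {xs = ℋ} Y∈)
  Y∩W≡S : Y ∩ W ≡ S
  Y∩W≡S = proj₂ (∈-filter⁻ (λ H → (H ∩ W) ≟ₛ S) {xs = ℋ} Y∈)

ProjIsEmptySet-intro : ∀ {n} {𝒯 : Hypergraph n} {W} → (∃[ Y₀ ] Y₀ ∈ 𝒯) → (∀ {Y} → Y ∈ 𝒯 → Y ∩ W ≡ ⊥) →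
  ProjIsEmptySet 𝒯 W
ProjIsEmptySet-intro {𝒯 = 𝒯} {W} (Y₀ , Y₀∈𝒯) traces≡⊥ X =
  (λ (X∈ , _) → trace≡⊥ X∈) ,
  λ { refl → subst (_∈ map (_∩ W) 𝒯) (traces≡⊥ Y₀∈𝒯) (∈-map⁺ (_∩ W) Y₀∈𝒯) , λ Y∈ _ → trace≡⊥ Y∈ }
  where
  trace≡⊥ : ∀ {X} → X ∈ map (_∩ W) 𝒯 → X ≡ ⊥
  trace≡⊥ X∈ with ∈-map⁻ (_∩ W) X∈
  ... | Y , Y∈𝒯 , refl = traces≡⊥ Y∈𝒯

∩-nonempty : ∀ {n} {ℋ : Hypergraph n} {V₁ V₂ S₁ H₀} → Sperner ℋ → V₁ ∪ V₂ ≡ ⊤ → H₀ ∈ ℋ → H₀ ∩ V₁ ≡ S₁ →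
  ¬ ProjIsEmptySet (traceEq ℋ V₁ S₁) V₂ → Nonempty (H₀ ∩ V₂)
∩-nonempty {V₁ = V₁} {V₂} {S₁} {H₀} sperner V₁∪V₂≡⊤ H₀∈ℋ H₀∩V₁≡S₁ proj≢[∅] with nonempty? (H₀ ∩ V₂)
... | yes H₀∩V₂≢∅ = H₀∩V₂≢∅
... | no  H₀∩V₂≡∅ = ⊥-elim (proj≢[∅] (ProjIsEmptySet-intro (H₀ , ∈-filter⁺ (λ H → (H ∩ V₁) ≟ₛ S₁) H₀∈ℋ H₀∩V₁≡S₁)
  λ Y∈ → trans (cong (_∩ V₂) (traceEq-unique sperner H₀∈ℋ H₀⊆V₁ H₀∩V₁≡S₁ Y∈)) H₀∩V₂≡⊥))
  where
  H₀∩V₂≡⊥ : H₀ ∩ V₂ ≡ ⊥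
  H₀∩V₂≡⊥ = Empty-unique H₀∩V₂≡∅
  H₀⊆V₁ : H₀ ⊆ V₁
  H₀⊆V₁ = ∪≡⊤⇒∩≡⊥⇒⊆ V₁∪V₂≡⊤ H₀∩V₂≡⊥

lemma1 : ∀ {n} (ℋ : Hypergraph n) (V₁ V₂ S₁ S₂ H₀ : Subset n) →
    Unimodular ℋ → Sperner ℋ →
    V₁ ∩ V₂ ≡ ⊥ → V₁ ∪ V₂ ≡ ⊤ → Nonempty V₁ → Nonempty V₂ →
    S₁ ⊆ V₁ → S₂ ⊆ V₂ → Nonempty S₁ → Nonempty S₂ →
    (∀ {H} → H ∈ ℋ → Nonempty (H ∩ V₁) → Nonempty (H ∩ V₂) →
      (H ∩ V₁ ≡ S₁) ⊎ (H ∩ V₂ ≡ S₂)) →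
    (∃[ H ] H ∈ traceEq ℋ V₁ S₁) →
    ¬ ProjIsEmptySet (traceEq ℋ V₁ S₁) V₂ →
    (∃[ H ] H ∈ traceEq ℋ V₂ S₂) →
    ¬ ProjIsEmptySet (traceEq ℋ V₂ S₂) V₁ →
    ∣ V₁ ∣ + card (restrict ℋ V₁ ++ traceEq ℋ V₂ S₂) ≥ 4 →
    ∣ V₂ ∣ + card (restrict ℋ V₂ ++ traceEq ℋ V₁ S₁) ≥ 4 →
    H₀ ∈ ℋ → H₀ ⊆ S₁ ∪ S₂ → H₀ ∩ V₁ ≡ S₁ → H₀ ∩ V₂ ⊆ S₂ →
    Unimodular (barH₁ ℋ V₁ V₂ S₂ H₀) × Unimodular (barH₂ ℋ V₁ V₂ S₁)
lemma1 {n} ℋ V₁ V₂ S₁ S₂ H₀ U sperner V₁∩V₂≡⊥ V₁∪V₂≡⊤ _ _ S₁⊆V₁ S₂⊆V₂ (s₁ , s₁∈S₁) _ _ _ proj≢[∅] _ _ _ _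
       H₀∈ℋ _ H₀∩V₁≡S₁ H₀∩V₂⊆S₂ =
  Unimodular-reindex (old V₂) (mergeInto s₂) (mergeInto-injective s₂∈V₂)
    (All.++⁺ (restrict-reindexes ℋ (∩≡⊥⇒disjoint V₁∩V₂≡⊥) s₂∈V₂)
    (All.++⁺ (traceEq-reindexes ℋ S₂⊆V₂ (H₀∩V₂⊆S₂ s₂∈H₀∩V₂))
             ((H₀ , H₀∈ℋ , withNew-reindexes S₂⊆V₂ H₀∩V₂⊆S₂ (proj₁ (x∈p∩q⁻ H₀ V₂ s₂∈H₀∩V₂))) ∷ []))) U ,
  Unimodular-reindex (old V₁) (mergeInto s₁) (mergeInto-injective (S₁⊆V₁ s₁∈S₁))
    (All.++⁺ (restrict-reindexes ℋ (λ u∈V₂ u∈V₁ → ∩≡⊥⇒disjoint V₁∩V₂≡⊥ u∈V₁ u∈V₂) (S₁⊆V₁ s₁∈S₁))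
             (traceEq-reindexes ℋ S₁⊆V₁ s₁∈S₁)) U
  where
  H₀∩V₂-nonempty : Nonempty (H₀ ∩ V₂)
  H₀∩V₂-nonempty = ∩-nonempty sperner V₁∪V₂≡⊤ H₀∈ℋ H₀∩V₁≡S₁ proj≢[∅]
  s₂ : Fin n
  s₂ = proj₁ H₀∩V₂-nonempty
  s₂∈H₀∩V₂ : s₂ ∈ₛ H₀ ∩ V₂
  s₂∈H₀∩V₂ = proj₂ H₀∩V₂-nonempty
  s₂∈V₂ : s₂ ∈ₛ V₂
  s₂∈V₂ = proj₂ (x∈p∩q⁻ H₀ V₂ s₂∈H₀∩V₂)
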